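{- Let $m,n\ge2$ with $m$ even, and let $A$ be an $m\times n$ matrix. Applying to $A$ the sequence of rotations $C_1^{m-1} R^2 C_1^2 R^{n-1} C_1\,(R C_1 R^{n-1} C_1)^{\frac m2-1} R^{n-1} C_1$ swaps the elements in positions $R[1]$ and $R[n]$ and leaves every other element in its original position.
   Context: Rows and columns are numbered from $1$. $R$ denotes the first row and $C_1$ the first column; $R[j]$ is the position in row $1$, column $j$. In a sequence of rotations, the symbol $R$ denotes one unit rightward rotation of the first row (the element in column $j$ moves to column $j+1$ for $j<n$, and the element in column $n$ moves to column $1$), and $C_1$ denotes one unit downward rotation of the first column (the element in row $i$ moves to row $i+1$ for $i<m$, and the element in row $m$ moves to row $1$). A superscript $k\ge0$ denotes $k$ consecutive repetitions, juxtaposition denotes concatenation, and sequences are applied from left to right. -}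

module Defs where

open import Data.Nat using (ℕ; zero; suc; _∸_; _/_)
open import Data.Fin using (Fin; zero; suc; fromℕ; inject₁)
open import Data.List using (List; []; _∷_; _++_; replicate; concat)
open import Function using (_∘_)
open import Data.Fin using (toℕ)
open import Data.Nat using (_≡ᵇ_)
open import Data.Bool using (if_then_else_)

-- An m×n matrix with entries in A; rows and columns indexed from 0
-- (index 0 = row/column 1 of the paper).
Matrix : Set → ℕ → ℕ → Set
Matrix A m n = Fin m → Fin n → A

cycPred : ∀ {k} → Fin k → Fin k
cycPred {suc k} zero = fromℕ k
cycPred (suc i) = inject₁ i

-- R: rotate the first row one step right: element in column j moves to
-- column j+1, element in column n moves to column 1.
rotR : ∀ {A m n} → Matrix A m n → Matrix A m n
rotR M zero j = M zero (cycPred j)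
rotR M (suc i) j = M (suc i) j

-- C₁: rotate the first column one step down: element in row i moves to
-- row i+1, element in row m moves to row 1.
rotC : ∀ {A m n} → Matrix A m n → Matrix A m n
rotC M i zero = M (cycPred i) zero
rotC M i (suc j) = M i (suc j)

data Move : Set where
  R C : Move

applyMove : ∀ {A m n} → Move → Matrix A m n → Matrix A m n
applyMove R = rotR
applyMove C = rotC

applySeq : ∀ {A m n} → List Move → Matrix A m n → Matrix A m n
applySeq [] M = M
applySeq (x ∷ xs) M = applySeq xs (applyMove x M)

pow : List Move → ℕ → List Move
pow xs k = concat (replicate k xs)

swapSeq : ℕ → ℕ → List Move
swapSeq m n =
  pow (C ∷ []) (m ∸ 1) ++ pow (R ∷ []) 2 ++ pow (C ∷ []) 2 ++
  pow (R ∷ []) (n ∸ 1) ++ (C ∷ []) ++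
  pow ((R ∷ C ∷ []) ++ pow (R ∷ []) (n ∸ 1) ++ (C ∷ [])) (m / 2 ∸ 1) ++
  pow (R ∷ []) (n ∸ 1) ++ (C ∷ [])

swapCol : ∀ {n} → Fin n → Fin n
swapCol {suc k} j =
  if toℕ j ≡ᵇ 0 then fromℕ k
  else if toℕ j ≡ᵇ k then zero
  else j

swapTarget : ∀ {A m n} → Matrix A m n → Matrix A m n
swapTarget M zero j = M zero (swapCol j)
swapTarget M (suc i) j = M (suc i) j

-- Every move permutes positions, so after a sequence of moves the entry at p is
-- the original entry at the source of p, obtained by composing the source maps of
-- the moves; we compute that composite in ℕ-coordinates. Write R⁻¹ = R^{n-1}. The
-- block B = R C₁ R⁻¹ C₁ only moves the m+1 entries R[1], R[n], (2,1), …, (m,1),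
-- and in this order its source map rotates them backwards by two places. Hence
-- B^{m/2-1} rotates them by -(m-2) ≡ 3 (mod m+1), and composing with the short
-- prefix and suffix of the sequence leaves exactly the transposition of R[1] and
-- R[n]; entries outside the first row and column never move.
module Submission where

open import Defs
open import Data.Nat using (ℕ; _≤_)
open import Data.Nat.Divisibility using (_∣_)
open import Relation.Binary.PropositionalEquality using (_≡_)

open import Data.Bool using (true; false; T)
open import Data.Fin using (Fin; zero; suc; toℕ)
open import Data.Fin.Properties using (toℕ-fromℕ; toℕ-inject₁; toℕ-injective; toℕ<n)
open import Data.List using (List; []; _∷_; _++_; foldr)
open import Data.List.Properties using (foldr-++; foldr-fusion)
open import Data.Nat using (zero; suc; _+_; _*_; _∸_; _/_; _<_; _≡ᵇ_; z≤n; s≤s; z<s)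
open import Data.Nat.DivMod using (m*n/n≡m)
open import Data.Nat.Divisibility using (divides)
open import Data.Nat.GeneralisedArithmetic using (fold; fold-+; fold-*)
open import Data.Nat.Properties
  using (+-comm; +-suc; +-identityʳ; ≤-pred; ≤-trans; n<1+n; n≤1+n; m≤n+m; ≤∧≢⇒<;
         m≤n⇒m<n∨m≡n; m≤n⇒∃[o]m+o≡n; ≡ᵇ⇒≡; ≡⇒≡ᵇ)
open import Data.Product using (_×_; _,_; proj₁; proj₂; uncurry)
open import Data.Sum using (inj₁; inj₂)
open import Data.Unit using (tt)
open import Function using (id)
open import Relation.Binary.PropositionalEquality
  using (_≢_; refl; sym; trans; cong; cong₂; subst; module ≡-Reasoning)
open ≡-Reasoning

fold-fixed : ∀ {A : Set} {f : A → A} {x : A} → f x ≡ x → ∀ a → fold x f a ≡ x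
fold-fixed fx≡x zero = refl
fold-fixed {f = f} fx≡x (suc a) = trans (cong f (fold-fixed fx≡x a)) fx≡x

fold-commute : ∀ {A B : Set} {f : B → B} {h : A → A} (g : A → B) →
               (∀ x → f (g x) ≡ g (h x)) → ∀ a x → fold (g x) f a ≡ g (fold x h a)
fold-commute g comm zero x = refl
fold-commute {f = f} {h} g comm (suc a) x =
  trans (cong f (fold-commute g comm a x)) (comm (fold x h a))

foldr-pow : ∀ {B : Set} (f : Move → B → B) x xs a →
            foldr f x (pow xs a) ≡ fold x (λ y → foldr f y xs) a
foldr-pow f x xs zero = refl
foldr-pow f x xs (suc a) =
  trans (foldr-++ f x xs (pow xs a)) (cong (λ y → foldr f y xs) (foldr-pow f x xs a))

cycPredℕ : ℕ → ℕ → ℕ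
cycPredℕ N zero    = N
cycPredℕ N (suc i) = i

toℕ-cycPred : ∀ {N} (i : Fin (suc N)) → toℕ (cycPred i) ≡ cycPredℕ N (toℕ i)
toℕ-cycPred {N} zero = toℕ-fromℕ N
toℕ-cycPred (suc i)  = toℕ-inject₁ i

cycPredℕ-descend : ∀ N t a → fold (t + a) (cycPredℕ N) a ≡ t
cycPredℕ-descend N t zero    = +-identityʳ t
cycPredℕ-descend N t (suc a) = cong (cycPredℕ N) (begin
  fold (t + suc a) (cycPredℕ N) a ≡⟨ cong (λ s → fold s (cycPredℕ N) a) (+-suc t a) ⟩
  fold (suc t + a) (cycPredℕ N) a ≡⟨ cycPredℕ-descend N (suc t) a ⟩
  suc t                           ∎)

cycPredℕ-period : ∀ {N i} → i ≤ N → fold i (cycPredℕ N) (suc N) ≡ i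
cycPredℕ-period {i = i} i≤N with m≤n⇒∃[o]m+o≡n i≤N
... | d , refl = begin
  fold i p (suc (i + d))
    ≡⟨ cong (fold i p) (trans (cong suc (+-comm i d)) (sym (+-suc d i))) ⟩
  fold i p (d + suc i)
    ≡⟨ fold-+ i p d ⟩
  fold (p (fold i p i)) p d
    ≡⟨ cong (λ s → fold (p s) p d) (cycPredℕ-descend (i + d) 0 i) ⟩
  fold (i + d) p d
    ≡⟨ cycPredℕ-descend (i + d) i d ⟩
  i ∎
  where p = cycPredℕ (i + d)

cycPredℕ-undo : ∀ {N} a {b u} → a + b ≡ suc N → b + u ≤ N →
                fold u (cycPredℕ N) a ≡ b + u
cycPredℕ-undo {N} a {b} {u} a+b≡1+N b+u≤N = begin
  fold u p a                  ≡⟨ cong (λ s → fold s p a) (sym (cycPredℕ-descend N u b)) ⟩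
  fold (fold (u + b) p b) p a ≡⟨ sym (fold-+ (u + b) p a) ⟩
  fold (u + b) p (a + b)      ≡⟨ cong (fold (u + b) p) a+b≡1+N ⟩
  fold (u + b) p (suc N)      ≡⟨ cycPredℕ-period (subst (_≤ N) (+-comm b u) b+u≤N) ⟩
  u + b                       ≡⟨ +-comm u b ⟩
  b + u                       ∎
  where p = cycPredℕ N

cycPredℕ-shift3 : ∀ a {u} → 3 + u ≤ 2 + a → fold u (cycPredℕ (2 + a)) a ≡ 3 + u
cycPredℕ-shift3 a = cycPredℕ-undo a (+-comm a 3)

finSource : ∀ {m n} → Move → Fin m × Fin n → Fin m × Fin n
finSource R (zero  , j)     = zero , cycPred j
finSource R (suc i , j)     = suc i , j
finSource C (i     , zero)  = cycPred i , zero
finSource C (i     , suc j) = i , suc j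

applyMove-source : ∀ {A m n} mv (M : Matrix A m n) i j →
                   applyMove mv M i j ≡ uncurry M (finSource mv (i , j))
applyMove-source R M zero    j       = refl
applyMove-source R M (suc i) j       = refl
applyMove-source C M i       zero    = refl
applyMove-source C M i       (suc j) = refl

applySeq-source : ∀ {A m n} xs (M : Matrix A m n) i j →
                  applySeq xs M i j ≡ uncurry M (foldr finSource (i , j) xs)
applySeq-source []        M i j = refl
applySeq-source (mv ∷ xs) M i j =
  trans (applySeq-source xs (applyMove mv M) i j) (applyMove-source mv M _ _)

Pos : Set
Pos = ℕ × ℕ

-- rows 0 … m₁ and columns 0 … n₁; ρ and γ are the source maps of R and C₁
module Grid (m₁ n₁ : ℕ) where

  ρ γ : Pos → Pos
  ρ (zero  , j) = zero , cycPredℕ n₁ j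
  ρ (suc i , j) = suc i , j
  γ (i , zero)  = cycPredℕ m₁ i , zero
  γ (i , suc j) = i , suc j

  source : Move → Pos → Pos
  source R = ρ
  source C = γ

  toℕ² : Fin (suc m₁) × Fin (suc n₁) → Pos
  toℕ² (i , j) = toℕ i , toℕ j

  toℕ²-injective : ∀ {p q} → toℕ² p ≡ toℕ² q → p ≡ q
  toℕ²-injective {_ , _} {_ , _} eq =
    cong₂ _,_ (toℕ-injective (cong proj₁ eq)) (toℕ-injective (cong proj₂ eq))

  toℕ²-finSource : ∀ mv p → toℕ² (finSource mv p) ≡ source mv (toℕ² p)
  toℕ²-finSource R (zero  , j)     = cong (0 ,_) (toℕ-cycPred j)
  toℕ²-finSource R (suc i , j)     = refl
  toℕ²-finSource C (i     , zero)  = cong (_, 0) (toℕ-cycPred i)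
  toℕ²-finSource C (i     , suc j) = refl

  ρ⁻¹ γ⁻¹ : Pos → Pos
  ρ⁻¹ p = fold p ρ n₁
  γ⁻¹ p = fold p γ m₁

  ρ⁻¹-off-row : ∀ i j → ρ⁻¹ (suc i , j) ≡ (suc i , j)
  ρ⁻¹-off-row i j = fold-fixed refl n₁

  ρ⁻¹-on-row : ∀ j → ρ⁻¹ (0 , j) ≡ (0 , fold j (cycPredℕ n₁) n₁)
  ρ⁻¹-on-row = fold-commute (0 ,_) (λ _ → refl) n₁

  ρ⁻¹-row : ∀ {j} → j < n₁ → ρ⁻¹ (0 , j) ≡ (0 , suc j)
  ρ⁻¹-row j<n₁ =
    trans (ρ⁻¹-on-row _) (cong (0 ,_) (cycPredℕ-undo n₁ (+-comm n₁ 1) j<n₁))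

  ρ⁻¹-row-end : ρ⁻¹ (0 , n₁) ≡ (0 , 0)
  ρ⁻¹-row-end = trans (ρ⁻¹-on-row n₁) (cong (0 ,_) (cycPredℕ-descend n₁ 0 n₁))

  γ⁻¹-off-col : ∀ i j → γ⁻¹ (i , suc j) ≡ (i , suc j)
  γ⁻¹-off-col i j = fold-fixed refl m₁

  γ⁻¹-on-col : ∀ i → γ⁻¹ (i , 0) ≡ (fold i (cycPredℕ m₁) m₁ , 0)
  γ⁻¹-on-col = fold-commute (_, 0) (λ _ → refl) m₁

  γ⁻¹-col : ∀ {i} → i < m₁ → γ⁻¹ (i , 0) ≡ (suc i , 0)
  γ⁻¹-col i<m₁ =
    trans (γ⁻¹-on-col _) (cong (_, 0) (cycPredℕ-undo m₁ (+-comm m₁ 1) i<m₁))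

  γ⁻¹-col-end : γ⁻¹ (m₁ , 0) ≡ (0 , 0)
  γ⁻¹-col-end = trans (γ⁻¹-on-col m₁) (cong (_, 0) (cycPredℕ-descend m₁ 0 m₁))

module Hook (m₂ n₂ : ℕ) where
  open Grid (suc m₂) (suc n₂) public

  -- source maps of R^{n-1} C₁, of the block R C₁ R^{n-1} C₁, and of C₁^{m-1} R² C₁²
  pre β post : Pos → Pos
  pre p  = ρ⁻¹ (γ p)
  β p    = ρ (γ (pre p))
  post p = γ⁻¹ (ρ (ρ (γ (γ p))))

  source-pre : ∀ ys p →
               foldr source p (pow (R ∷ []) (suc n₂) ++ C ∷ ys) ≡ pre (foldr source p ys)
  source-pre ys p =
    trans (foldr-++ source p (pow (R ∷ []) (suc n₂)) (C ∷ ys))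
          (foldr-pow source (γ (foldr source p ys)) (R ∷ []) (suc n₂))

  block : List Move
  block = R ∷ C ∷ pow (R ∷ []) (suc n₂) ++ C ∷ []

  source-block : ∀ x → foldr source x block ≡ β x
  source-block x = cong (λ q → ρ (γ q)) (source-pre [] x)

  swapSeq-source : ∀ p → foldr source p (swapSeq (2 + m₂) (2 + n₂)) ≡
                         post (pre (fold (pre p) β ((2 + m₂) / 2 ∸ 1)))
  swapSeq-source p = begin
    foldr source p (swapSeq (2 + m₂) (2 + n₂))
      ≡⟨ trans (foldr-++ source p (pow (C ∷ []) (suc m₂)) _)
               (foldr-pow source _ (C ∷ []) (suc m₂)) ⟩
    γ⁻¹ (ρ (ρ (γ (γ (foldr source p (pow (R ∷ []) (suc n₂) ++ C ∷ blocks))))))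
      ≡⟨ cong (λ q → γ⁻¹ (ρ (ρ (γ (γ q))))) (source-pre blocks p) ⟩
    post (pre (foldr source p (pow block a ++ pow (R ∷ []) (suc n₂) ++ C ∷ [])))
      ≡⟨ cong (λ q → post (pre q)) (foldr-++ source p (pow block a) _) ⟩
    post (pre (foldr source (foldr source p (pow (R ∷ []) (suc n₂) ++ C ∷ [])) (pow block a)))
      ≡⟨ cong (λ q → post (pre (foldr source q (pow block a)))) (source-pre [] p) ⟩
    post (pre (foldr source (pre p) (pow block a)))
      ≡⟨ cong (λ q → post (pre q)) (foldr-pow source (pre p) block a) ⟩
    post (pre (fold (pre p) (λ x → foldr source x block) a))
      ≡⟨ cong (λ q → post (pre q)) (fold-commute id source-block a (pre p)) ⟩
    post (pre (fold (pre p) β a))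
      ∎
    where
    a = (2 + m₂) / 2 ∸ 1
    blocks = pow block a ++ pow (R ∷ []) (suc n₂) ++ C ∷ []

  orbit : ℕ → Pos
  orbit 0             = 0 , 0
  orbit 1             = 0 , suc n₂
  orbit (suc (suc t)) = suc t , 0

  ρ-col : ∀ t → ρ (t , 0) ≡ orbit (suc t)
  ρ-col zero    = refl
  ρ-col (suc t) = refl

  β-orbit : ∀ u → β (orbit u) ≡ orbit (cycPredℕ (2 + m₂) (cycPredℕ (2 + m₂) u))
  β-orbit 0                   = trans (cong (λ q → ρ (γ q)) (ρ⁻¹-off-row m₂ 0)) (ρ-col m₂)
  β-orbit 1                   = cong (λ q → ρ (γ q)) ρ⁻¹-row-end
  β-orbit 2                   = cong (λ q → ρ (γ q)) (ρ⁻¹-row z<s)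
  β-orbit (suc (suc (suc t))) = trans (cong (λ q → ρ (γ q)) (ρ⁻¹-off-row t 0)) (ρ-col t)

  fold-β-orbit : ∀ a u → fold (orbit u) β a ≡ orbit (fold u (cycPredℕ (2 + m₂)) (a * 2))
  fold-β-orbit a u =
    trans (fold-commute orbit β-orbit a u) (cong orbit (sym (fold-* u (cycPredℕ (2 + m₂)) a)))

  β-row : ∀ {c} → suc c < suc n₂ → β (0 , suc c) ≡ (0 , suc c)
  β-row c<n₂ = cong (λ q → ρ (γ q)) (ρ⁻¹-row c<n₂)

  pre-off-hook : ∀ i j → pre (suc i , suc j) ≡ (suc i , suc j)
  pre-off-hook i j = ρ⁻¹-off-row i (suc j)

  β-off-hook : ∀ i j → β (suc i , suc j) ≡ (suc i , suc j)
  β-off-hook i j = cong (λ q → ρ (γ q)) (pre-off-hook i j)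

  post-pre-row : ∀ {c} → suc c < suc n₂ → post (pre (0 , suc c)) ≡ γ⁻¹ (0 , c)
  post-pre-row c<n₂ = cong post (ρ⁻¹-row c<n₂)

  post-pre-1 : post (pre (1 , 0)) ≡ (0 , suc n₂)
  post-pre-1 = trans (cong post (ρ⁻¹-row z<s)) (γ⁻¹-off-col 0 n₂)

  post-pre-2 : post (pre (2 , 0)) ≡ (0 , 0)
  post-pre-2 = trans (cong post (ρ⁻¹-off-row 0 0)) γ⁻¹-col-end

  post-pre-3 : post (pre (3 , 0)) ≡ γ⁻¹ (0 , n₂)
  post-pre-3 = cong post (ρ⁻¹-off-row 1 0)

  post-pre-col : ∀ {t} → t < m₂ → post (pre (4 + t , 0)) ≡ (2 + t , 0)
  post-pre-col {t} t<m₂ = trans (cong post (ρ⁻¹-off-row (2 + t) 0)) (γ⁻¹-col (s≤s t<m₂))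

module TallHook (m₃ n₂ : ℕ) where
  open Hook (2 + m₃) n₂

  post-pre-origin : post (pre (0 , 0)) ≡ (2 + m₃ , 0)
  post-pre-origin = trans (cong post (ρ⁻¹-off-row (2 + m₃) 0)) (γ⁻¹-col (n≤1+n (2 + m₃)))

  post-pre-corner : post (pre (0 , suc n₂)) ≡ (3 + m₃ , 0)
  post-pre-corner = trans (cong post ρ⁻¹-row-end) (γ⁻¹-col (n<1+n (2 + m₃)))

module Swap (n₂ : ℕ) where
  -- m = 2 + k * 2 rows, so the sequence contains k = m/2 - 1 blocks
  module H (k : ℕ) = Hook (k * 2) n₂
  open H

  σ : ℕ → Pos → Pos
  σ k p = post k (pre k (fold (pre k p) (β k) k))

  βᵏ-orbit : ∀ k u {v} → fold u (cycPredℕ (2 + k * 2)) (k * 2) ≡ v →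
             fold (orbit k u) (β k) k ≡ orbit k v
  βᵏ-orbit k u shift = trans (fold-β-orbit k k u) (cong (orbit k) shift)

  σ-orbit : ∀ k p u {v} → pre k p ≡ orbit k u →
            fold u (cycPredℕ (2 + k * 2)) (k * 2) ≡ v →
            σ k p ≡ post k (pre k (orbit k v))
  σ-orbit k p u pre≡ shift =
    cong (λ q → post k (pre k q))
         (trans (cong (λ q → fold q (β k) k) pre≡) (βᵏ-orbit k u shift))

  σ-origin : ∀ k → σ k (0 , 0) ≡ (0 , suc n₂)
  σ-origin k =
    trans (σ-orbit k (0 , 0) (2 + k * 2) (ρ⁻¹-off-row k (k * 2) 0)
                   (cycPredℕ-descend _ 2 (k * 2)))
          (post-pre-1 k)

  σ-corner : ∀ k → σ k (0 , suc n₂) ≡ (0 , 0)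
  σ-corner zero = begin
    post 0 (pre 0 (pre 0 (0 , suc n₂))) ≡⟨ cong (λ q → post 0 (pre 0 q)) (ρ⁻¹-row-end 0) ⟩
    post 0 (pre 0 (0 , 0))              ≡⟨ cong (post 0) (ρ⁻¹-off-row 0 0 0) ⟩
    post 0 (1 , 0)                      ≡⟨ γ⁻¹-col-end 0 ⟩
    (0 , 0)                             ∎
  σ-corner (suc k) =
    trans (σ-orbit (suc k) (0 , suc n₂) 0 (ρ⁻¹-row-end (suc k))
                   (cycPredℕ-shift3 (suc k * 2) (s≤s (s≤s (s≤s z≤n)))))
          (post-pre-2 (suc k))

  post-pre-βᵏ-row : ∀ k {c} → c < suc n₂ →
                    post k (pre k (fold (0 , suc c) (β k) k)) ≡ γ⁻¹ k (0 , c)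
  post-pre-βᵏ-row k c≤n₂ with m≤n⇒m<n∨m≡n (≤-pred c≤n₂)
  ... | inj₁ c<n₂ =
    trans (cong (λ q → post k (pre k q)) (fold-fixed (β-row k (s≤s c<n₂)) k))
          (post-pre-row k (s≤s c<n₂))
  ... | inj₂ refl = row-end k
    where
    row-end : ∀ k → post k (pre k (fold (0 , suc n₂) (β k) k)) ≡ γ⁻¹ k (0 , n₂)
    row-end zero    = cong (post 0) (ρ⁻¹-row-end 0)
    row-end (suc k) =
      trans (cong (λ q → post (suc k) (pre (suc k) q))
                  (βᵏ-orbit (suc k) 1
                            (cycPredℕ-shift3 (suc k * 2) (s≤s (s≤s (s≤s (s≤s z≤n)))))))
            (post-pre-3 (suc k))

  σ-row : ∀ k {c} → suc c < suc n₂ → σ k (0 , suc c) ≡ (0 , suc c)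
  σ-row k c<n₂ =
    trans (cong (λ q → post k (pre k (fold q (β k) k))) (ρ⁻¹-row k c<n₂))
          (trans (post-pre-βᵏ-row k c<n₂) (γ⁻¹-off-col k 0 _))

  σ-col-1 : ∀ k → σ k (1 , 0) ≡ (1 , 0)
  σ-col-1 k =
    trans (cong (λ q → post k (pre k (fold q (β k) k))) (ρ⁻¹-row k z<s))
          (trans (post-pre-βᵏ-row k z<s) (γ⁻¹-col k z<s))

  σ-col-inner : ∀ k {t} → 2 + t < k * 2 → σ k (2 + t , 0) ≡ (2 + t , 0)
  σ-col-inner k {t} 3+t≤m₂ =
    trans (σ-orbit k (2 + t , 0) (2 + t) (ρ⁻¹-off-row k t 0)
                   (cycPredℕ-shift3 (k * 2) (s≤s (s≤s 3+t≤m₂))))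
          (post-pre-col k (≤-trans (m≤n+m (suc t) 2) 3+t≤m₂))

  σ-col-penultimate : ∀ k → σ (suc k) (suc k * 2 , 0) ≡ (suc k * 2 , 0)
  σ-col-penultimate k =
    trans (σ-orbit (suc k) (suc k * 2 , 0) (suc k * 2) (ρ⁻¹-off-row (suc k) (k * 2) 0)
                   (cycPredℕ-descend _ 0 (suc k * 2)))
          (TallHook.post-pre-origin (k * 2) n₂)

  σ-col-last : ∀ k → σ (suc k) (suc (suc k * 2) , 0) ≡ (suc (suc k * 2) , 0)
  σ-col-last k =
    trans (σ-orbit (suc k) (suc (suc k * 2) , 0) (1 + suc k * 2)
                   (ρ⁻¹-off-row (suc k) (suc (k * 2)) 0) (cycPredℕ-descend _ 1 (suc k * 2)))
          (TallHook.post-pre-corner (k * 2) n₂)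

  σ-col : ∀ k {i} → i < suc (k * 2) → σ k (suc i , 0) ≡ (suc i , 0)
  σ-col k       {zero}  _ = σ-col-1 k
  σ-col zero    {suc t} (s≤s ())
  σ-col (suc k) {suc t} (s≤s t≤m₂) with m≤n⇒m<n∨m≡n t≤m₂
  ... | inj₂ refl = σ-col-last k
  ... | inj₁ (s≤s t≤m₂-1) with m≤n⇒m<n∨m≡n t≤m₂-1
  ...   | inj₂ refl = σ-col-penultimate k
  ...   | inj₁ t<m₂-1 = σ-col-inner (suc k) (s≤s t<m₂-1)

  σ-off-hook : ∀ k i j → σ k (suc i , suc j) ≡ (suc i , suc j)
  σ-off-hook k i j = begin
    σ k (suc i , suc j)
      ≡⟨ cong (λ q → post k (pre k (fold q (β k) k))) (pre-off-hook k i j) ⟩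
    post k (pre k (fold (suc i , suc j) (β k) k))
      ≡⟨ cong (λ q → post k (pre k q)) (fold-fixed (β-off-hook k i j) k) ⟩
    post k (pre k (suc i , suc j))
      ≡⟨ cong (post k) (pre-off-hook k i j) ⟩
    γ⁻¹ k (suc i , suc j)
      ≡⟨ γ⁻¹-off-col k (suc i) j ⟩
    (suc i , suc j)
      ∎

  σ-top : ∀ k (j : Fin (2 + n₂)) → σ k (0 , toℕ j) ≡ (0 , toℕ (swapCol j))
  σ-top k zero = trans (σ-origin k) (cong (0 ,_) (sym (toℕ-fromℕ (suc n₂))))
  σ-top k (suc j) with toℕ j ≡ᵇ n₂ in eq
  ... | true  =
    trans (cong (λ c → σ k (0 , suc c)) (≡ᵇ⇒≡ _ _ (subst T (sym eq) tt))) (σ-corner k)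
  ... | false = σ-row k (s≤s (≤∧≢⇒< (≤-pred (toℕ<n j)) j≢n₂))
    where
    j≢n₂ : toℕ j ≢ n₂
    j≢n₂ j≡n₂ = subst T eq (≡⇒≡ᵇ _ _ j≡n₂)

  σ-below : ∀ k (i : Fin (suc (k * 2))) (j : Fin (2 + n₂)) →
            σ k (suc (toℕ i) , toℕ j) ≡ (suc (toℕ i) , toℕ j)
  σ-below k i zero    = σ-col k (toℕ<n i)
  σ-below k i (suc j) = σ-off-hook k (toℕ i) (toℕ j)

  toℕ²-swapSeq-source : ∀ k p →
    toℕ² k (foldr finSource p (swapSeq (suc k * 2) (2 + n₂))) ≡ σ k (toℕ² k p)
  toℕ²-swapSeq-source k p = begin
    toℕ² k (foldr finSource p moves)
      ≡⟨ foldr-fusion (toℕ² k) {g = source k} p (toℕ²-finSource k) moves ⟩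
    foldr (source k) (toℕ² k p) moves
      ≡⟨ swapSeq-source k (toℕ² k p) ⟩
    post k (pre k (fold (pre k (toℕ² k p)) (β k) (suc k * 2 / 2 ∸ 1)))
      ≡⟨ cong (λ a → post k (pre k (fold (pre k (toℕ² k p)) (β k) (a ∸ 1))))
              (m*n/n≡m (suc k) 2) ⟩
    σ k (toℕ² k p)
      ∎
    where moves = swapSeq (suc k * 2) (2 + n₂)

  swapSeq-source-top : ∀ k j →
    foldr finSource (zero , j) (swapSeq (suc k * 2) (2 + n₂)) ≡ (zero , swapCol j)
  swapSeq-source-top k j =
    toℕ²-injective k (trans (toℕ²-swapSeq-source k (zero , j)) (σ-top k j))

  swapSeq-source-below : ∀ k i j →
    foldr finSource (suc i , j) (swapSeq (suc k * 2) (2 + n₂)) ≡ (suc i , j)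
  swapSeq-source-below k i j =
    toℕ²-injective k (trans (toℕ²-swapSeq-source k (suc i , j)) (σ-below k i j))

lemma14 : ∀ {A : Set} (m n : ℕ) → 2 ≤ m → 2 ≤ n → 2 ∣ m →
    (M : Matrix A m n) → ∀ i j →
    applySeq (swapSeq m n) M i j ≡ swapTarget M i j
lemma14 _ zero           _  ()       _                      _ _       _
lemma14 _ (suc zero)     _  (s≤s ()) _                      _ _       _
lemma14 _ (suc (suc _))  () _        (divides zero refl)    _ _       _
lemma14 _ (suc (suc n₂)) _  _        (divides (suc k) refl) M zero    j =
  trans (applySeq-source (swapSeq (suc k * 2) (2 + n₂)) M zero j)
        (cong (uncurry M) (Swap.swapSeq-source-top n₂ k j))
lemma14 _ (suc (suc n₂)) _  _        (divides (suc k) refl) M (suc i) j =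
  trans (applySeq-source (swapSeq (suc k * 2) (2 + n₂)) M (suc i) j)
        (cong (uncurry M) (Swap.swapSeq-source-below n₂ k i j))
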